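{- Let $n\ge 1$ and let $G$ be a subgraph of the hypercube $Q_n$ with average degree $d$. Then $G$ contains a geodesic of length at least $d$.
   Context: The hypercube $Q_n$ has vertex set $\{0,1\}^n$, two vertices being adjacent if they differ in exactly one coordinate; the direction of an edge is that coordinate. A path in $Q_n$ is a geodesic if no two of its edges have the same direction. The length of a path is its number of edges. Here $d$ is a nonnegative real number. -}

module Defs where

open import Data.Nat using (ℕ; zero; suc; _+_; _*_)
open import Data.Bool using (Bool; true; false; not)
open import Data.Fin using (Fin)
open import Data.Vec using (Vec; []; _∷_; lookup; _[_]%=_; _[_]≔_)
open import Data.List using (List; []; _∷_; [_]; _++_; map; length; filterᵇ; allFin)
open import Data.Nat.ListAction using (sum)
open import Data.Product using (_×_)
open import Relation.Binary.PropositionalEquality using (_≡_)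

allVertices : (n : ℕ) → List (Vec Bool n)
allVertices zero = [ [] ]
allVertices (suc n) = map (false ∷_) (allVertices n) ++ map (true ∷_) (allVertices n)

flipAt : ∀ {n} → Vec Bool n → Fin n → Vec Bool n
flipAt x i = x [ i ]%= not

-- Every edge of Q_n is {x, flipAt x i} with lookup x i ≡ false; it is named by
-- the pair (x , i) with x its endpoint having coordinate i equal to false.
-- E x i = true means this edge belongs to G (only meaningful for such (x , i)).
record Subgraph (n : ℕ) : Set where
  field
    V : Vec Bool n → Bool
    E : Vec Bool n → Fin n → Bool
    edge-ok : ∀ x i → E x i ≡ true →
      lookup x i ≡ false × V x ≡ true × V (flipAt x i) ≡ true

open Subgraph public

numVertices : ∀ {n} → Subgraph n → ℕ
numVertices {n} G = length (filterᵇ (V G) (allVertices n))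

numEdges : ∀ {n} → Subgraph n → ℕ
numEdges {n} G = sum (map (λ x → length (filterᵇ (E G x) (allFin n))) (allVertices n))

HasEdge : ∀ {n} → Subgraph n → Vec Bool n → Fin n → Set
HasEdge G x i = E G (x [ i ]≔ false) i ≡ true

data PathFrom {n : ℕ} (G : Subgraph n) : Vec Bool n → List (Fin n) → Set where
  stop : ∀ {x} → V G x ≡ true → PathFrom G x []
  step : ∀ {x i ds} → HasEdge G x i → PathFrom G (flipAt x i) ds → PathFrom G x (i ∷ ds)

module Submission where

-- Induction on n, cutting Q_{n+1} along the first coordinate into two copies of Q_n.
-- Assign to each vertex x of G a number ℓ x such that some geodesic of G starting at x
-- has length at least ℓ x, and 2|E(G)| ≤ Σ_{x ∈ V(G)} ℓ x.  On each copy take ℓ from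
-- induction; if G contains the edge from x to its twin x' in the other copy, raise ℓ x
-- to max (ℓ x) (1 + ℓ x'): prefixing that edge to a geodesic inside the other copy
-- keeps it a geodesic, as no edge there has the first direction.  Each such edge adds
-- 2 to 2|E(G)| and at least 2 to the sum.  A vertex maximising ℓ is then at least
-- average, which gives a geodesic of length at least 2|E(G)|/|V(G)| = d.

open import Defs
open import Algebra.Properties.CommutativeSemigroup using (interchange)
open import Data.Bool using (Bool; true; false; not; if_then_else_; T?)
open import Data.Bool.Properties using (T-≡)
open import Data.Fin using (Fin; zero; suc)
import Data.Fin.Properties as Fin
open import Data.List using (List; []; _∷_; _++_; length; map; filterᵇ; allFin)
open import Data.List.Extrema.Nat using (argmax; argmax-sel; f[⊥]≤f[argmax]; f[xs]≤f[argmax])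
open import Data.List.Membership.Propositional using (_∈_)
open import Data.List.Membership.Propositional.Properties using (∈-filter⁻)
open import Data.List.Properties using (length-map; map-cong; map-++; map-∘; map-tabulate)
open import Data.List.Relation.Unary.All as All using (All; []; _∷_)
import Data.List.Relation.Unary.All.Properties as All
open import Data.List.Relation.Unary.AllPairs using ([]; _∷_)
open import Data.List.Relation.Unary.Any using (here; there)
open import Data.List.Relation.Unary.Unique.Propositional using (Unique)
import Data.List.Relation.Unary.Unique.Propositional.Properties as Unique
open import Data.Nat using (ℕ; zero; suc; _+_; _*_; _⊔_; _≤_; z≤n; s≤s; _≤?_)
open import Data.Nat.ListAction using (sum)
open import Data.Nat.ListAction.Properties using (sum-++)
open import Data.Nat.Properties
open import Data.Product using (Σ; _×_; _,_; proj₁; proj₂)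
open import Data.Sum using (inj₁; inj₂)
open import Data.Vec using (Vec; []; _∷_)
open import Function using (_∘_; Equivalence)
open import Relation.Binary.PropositionalEquality
open import Relation.Nullary using (yes; no)

private variable
  A B : Set
  n : ℕ

⟦_⟧ : Bool → ℕ
⟦ b ⟧ = if b then 1 else 0

sum-map-+ : (f g : A → ℕ) (xs : List A) →
  sum (map (λ x → f x + g x) xs) ≡ sum (map f xs) + sum (map g xs)
sum-map-+ f g [] = refl
sum-map-+ f g (x ∷ xs) =
  trans (cong (f x + g x +_) (sum-map-+ f g xs)) (interchange +-commutativeSemigroup (f x) (g x) _ _)

sum-map-*ˡ : (c : ℕ) (f : A → ℕ) (xs : List A) →
  sum (map (λ x → c * f x) xs) ≡ c * sum (map f xs)
sum-map-*ˡ c f [] = sym (*-zeroʳ c)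
sum-map-*ˡ c f (x ∷ xs) = trans (cong (c * f x +_) (sum-map-*ˡ c f xs)) (sym (*-distribˡ-+ c (f x) _))

sum-map-mono : {f g : A → ℕ} → (∀ x → f x ≤ g x) → (xs : List A) →
  sum (map f xs) ≤ sum (map g xs)
sum-map-mono f≤g [] = z≤n
sum-map-mono f≤g (x ∷ xs) = +-mono-≤ (f≤g x) (sum-map-mono f≤g xs)

sum-map-≤-length* : {f : A → ℕ} {c : ℕ} {xs : List A} → All (λ x → f x ≤ c) xs →
  sum (map f xs) ≤ length xs * c
sum-map-≤-length* [] = z≤n
sum-map-≤-length* (fx≤c ∷ fxs≤c) = +-mono-≤ fx≤c (sum-map-≤-length* fxs≤c)

sum-map-filterᵇ : (p : A → Bool) (f : A → ℕ) (xs : List A) →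
  sum (map f (filterᵇ p xs)) ≡ sum (map (λ x → if p x then f x else 0) xs)
sum-map-filterᵇ p f [] = refl
sum-map-filterᵇ p f (x ∷ xs) with p x
... | true = cong (f x +_) (sum-map-filterᵇ p f xs)
... | false = sum-map-filterᵇ p f xs

length-filterᵇ-∷ : (p : A → Bool) (x : A) (xs : List A) →
  length (filterᵇ p (x ∷ xs)) ≡ ⟦ p x ⟧ + length (filterᵇ p xs)
length-filterᵇ-∷ p x xs with p x
... | true = refl
... | false = refl

length-filterᵇ-map : (p : B → Bool) (f : A → B) (xs : List A) →
  length (filterᵇ p (map f xs)) ≡ length (filterᵇ (p ∘ f) xs)
length-filterᵇ-map p f [] = refl
length-filterᵇ-map p f (x ∷ xs) with p (f x)
... | true = cong suc (length-filterᵇ-map p f xs)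
... | false = length-filterᵇ-map p f xs

∃-≥-average : (f : A → ℕ) (xs : List A) → 1 ≤ length xs →
  Σ A λ x → x ∈ xs × sum (map f xs) ≤ length xs * f x
∃-≥-average f (z ∷ zs) _ =
  argmax f z zs , argmax∈ , sum-map-≤-length* (f[⊥]≤f[argmax] {f = f} z zs ∷ f[xs]≤f[argmax] {f = f} z zs)
  where
  argmax∈ : argmax f z zs ∈ z ∷ zs
  argmax∈ with argmax-sel f z zs
  ... | inj₁ ≡z = here ≡z
  ... | inj₂ ∈zs = there ∈zs

∈-filterᵇ⁻ : ∀ {p : A → Bool} {x} xs → x ∈ filterᵇ p xs → p x ≡ true
∈-filterᵇ⁻ {p = p} xs x∈ = Equivalence.to T-≡ (proj₂ (∈-filter⁻ (T? ∘ p) {xs = xs} x∈))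

sum-allVertices-suc : (f : Vec Bool (suc n) → ℕ) →
  sum (map f (allVertices (suc n))) ≡
    sum (map (f ∘ (false ∷_)) (allVertices n)) + sum (map (f ∘ (true ∷_)) (allVertices n))
sum-allVertices-suc {n} f = begin
  sum (map f (map (false ∷_) Qₙ ++ map (true ∷_) Qₙ))
    ≡⟨ cong sum (map-++ f (map (false ∷_) Qₙ) _) ⟩
  sum (map f (map (false ∷_) Qₙ) ++ map f (map (true ∷_) Qₙ))
    ≡⟨ sum-++ (map f (map (false ∷_) Qₙ)) _ ⟩
  sum (map f (map (false ∷_) Qₙ)) + sum (map f (map (true ∷_) Qₙ))
    ≡⟨ sym (cong₂ (λ xs ys → sum xs + sum ys) (map-∘ Qₙ) (map-∘ Qₙ)) ⟩
  sum (map (f ∘ (false ∷_)) Qₙ) + sum (map (f ∘ (true ∷_)) Qₙ) ∎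
  where open ≡-Reasoning
        Qₙ = allVertices n

LongGeodesic : Subgraph n → Vec Bool n → ℕ → Set
LongGeodesic {n} G x k = Σ (List (Fin n)) λ ds → PathFrom G x ds × Unique ds × k ≤ length ds

longGeodesic-⊔ : ∀ {G : Subgraph n} {x a b} →
  LongGeodesic G x a → LongGeodesic G x b → LongGeodesic G x (a ⊔ b)
longGeodesic-⊔ (ds , p , u , a≤) (es , q , v , b≤) with length ds ≤? length es
... | yes ds≤es = es , q , v , ⊔-lub (≤-trans a≤ ds≤es) b≤
... | no ds≰es = ds , p , u , ⊔-lub a≤ (≤-trans b≤ (≰⇒≥ ds≰es))

slice : Bool → Subgraph (suc n) → Subgraph n
slice b G = record
  { V = λ y → V G (b ∷ y)
  ; E = λ y i → E G (b ∷ y) (suc i)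
  ; edge-ok = λ y i → edge-ok G (b ∷ y) (suc i)
  }

matched : Subgraph (suc n) → Vec Bool n → Bool
matched G y = E G (false ∷ y) zero

matched⇒V : ∀ (G : Subgraph (suc n)) {y} → matched G y ≡ true → ∀ b → V G (b ∷ y) ≡ true
matched⇒V G m false = proj₁ (proj₂ (edge-ok G _ zero m))
matched⇒V G m true = proj₂ (proj₂ (edge-ok G _ zero m))

pathFrom-slice : ∀ {b} (G : Subgraph (suc n)) {y ds} →
  PathFrom (slice b G) y ds → PathFrom G (b ∷ y) (map suc ds)
pathFrom-slice G (stop v) = stop v
pathFrom-slice G (step e p) = step e (pathFrom-slice G p)

longGeodesic-slice : ∀ {b} (G : Subgraph (suc n)) {y k} →
  LongGeodesic (slice b G) y k → LongGeodesic G (b ∷ y) k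
longGeodesic-slice G {k = k} (ds , p , u , k≤) =
  map suc ds , pathFrom-slice G p , Unique.map⁺ Fin.suc-injective u , subst (k ≤_) (sym (length-map suc ds)) k≤

longGeodesic-across : ∀ {b} (G : Subgraph (suc n)) {y k} → matched G y ≡ true →
  LongGeodesic (slice (not b) G) y k → LongGeodesic G (b ∷ y) (suc k)
longGeodesic-across G {k = k} m (ds , p , u , k≤) =
  zero ∷ map suc ds , step m (pathFrom-slice G p) , zero∉ ∷ Unique.map⁺ Fin.suc-injective u ,
  s≤s (subst (k ≤_) (sym (length-map suc ds)) k≤)
  where zero∉ : All (zero ≢_) (map suc ds)
        zero∉ = All.map⁺ (All.universal (λ _ ()) ds)

upDegree : Subgraph n → Vec Bool n → ℕ
upDegree {n} G x = length (filterᵇ (E G x) (allFin n))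

allFin-suc : ∀ n → allFin (suc n) ≡ zero ∷ map suc (allFin n)
allFin-suc n = cong (zero ∷_) (sym (map-tabulate (λ i → i) suc))

upDegree-∷ : ∀ (G : Subgraph (suc n)) b y →
  upDegree G (b ∷ y) ≡ ⟦ E G (b ∷ y) zero ⟧ + upDegree (slice b G) y
upDegree-∷ {n} G b y = begin
  length (filterᵇ (E G (b ∷ y)) (allFin (suc n)))
    ≡⟨ cong (length ∘ filterᵇ (E G (b ∷ y))) (allFin-suc n) ⟩
  length (filterᵇ (E G (b ∷ y)) (zero ∷ map suc (allFin n)))
    ≡⟨ length-filterᵇ-∷ (E G (b ∷ y)) zero _ ⟩
  ⟦ E G (b ∷ y) zero ⟧ + length (filterᵇ (E G (b ∷ y)) (map suc (allFin n)))
    ≡⟨ cong (⟦ E G (b ∷ y) zero ⟧ +_) (length-filterᵇ-map (E G (b ∷ y)) suc (allFin n)) ⟩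
  ⟦ E G (b ∷ y) zero ⟧ + upDegree (slice b G) y ∎
  where open ≡-Reasoning

E-true-zero : ∀ (G : Subgraph (suc n)) y → E G (true ∷ y) zero ≡ false
E-true-zero G y with E G (true ∷ y) zero in e
... | false = refl
... | true with () ← proj₁ (edge-ok G (true ∷ y) zero e)

numEdges-suc : (G : Subgraph (suc n)) →
  numEdges G ≡
    sum (map (⟦_⟧ ∘ matched G) (allVertices n)) + (numEdges (slice false G) + numEdges (slice true G))
numEdges-suc {n} G = begin
  numEdges G
    ≡⟨ sum-allVertices-suc (upDegree G) ⟩
  sum (map (upDegree G ∘ (false ∷_)) Qₙ) + sum (map (upDegree G ∘ (true ∷_)) Qₙ)
    ≡⟨ cong₂ _+_ (cong sum (map-cong (upDegree-∷ G false) Qₙ)) (cong sum (map-cong upDegree-true Qₙ)) ⟩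
  sum (map (λ y → ⟦ matched G y ⟧ + upDegree (slice false G) y) Qₙ) + numEdges (slice true G)
    ≡⟨ cong (_+ numEdges (slice true G)) (sum-map-+ (⟦_⟧ ∘ matched G) (upDegree (slice false G)) Qₙ) ⟩
  (sum (map (⟦_⟧ ∘ matched G) Qₙ) + numEdges (slice false G)) + numEdges (slice true G)
    ≡⟨ +-assoc (sum (map (⟦_⟧ ∘ matched G) Qₙ)) _ _ ⟩
  sum (map (⟦_⟧ ∘ matched G) Qₙ) + (numEdges (slice false G) + numEdges (slice true G)) ∎
  where
  open ≡-Reasoning
  Qₙ = allVertices n
  upDegree-true : ∀ y → upDegree G (true ∷ y) ≡ upDegree (slice true G) y
  upDegree-true y =
    trans (upDegree-∷ G true y) (cong (λ b → ⟦ b ⟧ + upDegree (slice true G) y) (E-true-zero G y))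

potential : Subgraph n → (Vec Bool n → ℕ) → ℕ
potential {n} G ℓ = sum (map (λ x → if V G x then ℓ x else 0) (allVertices n))

record GeodesicBound (G : Subgraph n) : Set where
  field
    bound : Vec Bool n → ℕ
    realised : ∀ x → V G x ≡ true → LongGeodesic G x (bound x)
    edges≤potential : 2 * numEdges G ≤ potential G bound

open GeodesicBound

viaMatching : Bool → ℕ → ℕ → ℕ
viaMatching m own other = if m then own ⊔ suc other else own

glue : Subgraph (suc n) → (Bool → Vec Bool n → ℕ) → Vec Bool (suc n) → ℕ
glue G ℓ (b ∷ y) = viaMatching (matched G y) (ℓ b y) (ℓ (not b) y)

glue-realised : (G : Subgraph (suc n)) (ℓ : Bool → Vec Bool n → ℕ) →
  (∀ b y → V G (b ∷ y) ≡ true → LongGeodesic (slice b G) y (ℓ b y)) →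
  ∀ x → V G x ≡ true → LongGeodesic G x (glue G ℓ x)
glue-realised G ℓ γ (b ∷ y) v with matched G y in m
... | false = longGeodesic-slice G (γ b y v)
... | true = longGeodesic-⊔ (longGeodesic-slice G (γ b y v))
                            (longGeodesic-across G m (γ (not b) y (matched⇒V G m (not b))))

-- Both endpoints of a matching edge can extend their geodesic across it, so each bound grows by 1.
matching-gain : ∀ m v₀ v₁ a₀ a₁ → (m ≡ true → v₀ ≡ true) → (m ≡ true → v₁ ≡ true) →
  2 * ⟦ m ⟧ + ((if v₀ then a₀ else 0) + (if v₁ then a₁ else 0))
    ≤ (if v₀ then viaMatching m a₀ a₁ else 0) + (if v₁ then viaMatching m a₁ a₀ else 0)
matching-gain false v₀ v₁ a₀ a₁ _ _ = ≤-refl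
matching-gain true v₀ v₁ a₀ a₁ v₀≡ v₁≡ rewrite v₀≡ refl | v₁≡ refl = begin
  2 + (a₀ + a₁)     ≡⟨ sym (trans (+-comm (suc a₁) (suc a₀)) (cong suc (+-suc a₀ a₁))) ⟩
  suc a₁ + suc a₀   ≤⟨ +-mono-≤ (m≤n⊔m a₀ (suc a₁)) (m≤n⊔m a₁ (suc a₀)) ⟩
  (a₀ ⊔ suc a₁) + (a₁ ⊔ suc a₀) ∎
  where open ≤-Reasoning

glue-edges≤potential : (G : Subgraph (suc n)) (ℓ : Bool → Vec Bool n → ℕ) →
  (∀ b → 2 * numEdges (slice b G) ≤ potential (slice b G) (ℓ b)) →
  2 * numEdges G ≤ potential G (glue G ℓ)
glue-edges≤potential {n} G ℓ ih = begin
  2 * numEdges G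
    ≡⟨ cong (2 *_) (numEdges-suc G) ⟩
  2 * (M + (E₀ + E₁))
    ≡⟨ trans (*-distribˡ-+ 2 M _) (cong (2 * M +_) (*-distribˡ-+ 2 E₀ E₁)) ⟩
  2 * M + (2 * E₀ + 2 * E₁)
    ≤⟨ +-monoʳ-≤ (2 * M) (+-mono-≤ (ih false) (ih true)) ⟩
  2 * M + (P₀ + P₁)
    ≡⟨ sym (cong₂ _+_ (sum-map-*ˡ 2 m Qₙ) (sum-map-+ (w false) (w true) Qₙ)) ⟩
  sum (map (λ y → 2 * m y) Qₙ) + sum (map (λ y → w false y + w true y) Qₙ)
    ≡⟨ sym (sum-map-+ (λ y → 2 * m y) (λ y → w false y + w true y) Qₙ) ⟩
  sum (map (λ y → 2 * m y + (w false y + w true y)) Qₙ)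
    ≤⟨ sum-map-mono gain Qₙ ⟩
  sum (map (λ y → W false y + W true y) Qₙ)
    ≡⟨ sum-map-+ (W false) (W true) Qₙ ⟩
  sum (map (W false) Qₙ) + sum (map (W true) Qₙ)
    ≡⟨ sym (sum-allVertices-suc (λ x → if V G x then glue G ℓ x else 0)) ⟩
  potential G (glue G ℓ) ∎
  where
  open ≤-Reasoning
  Qₙ = allVertices n
  m : Vec Bool n → ℕ
  m = ⟦_⟧ ∘ matched G
  M = sum (map m Qₙ)
  E₀ = numEdges (slice false G)
  E₁ = numEdges (slice true G)
  P₀ = potential (slice false G) (ℓ false)
  P₁ = potential (slice true G) (ℓ true)
  w W : Bool → Vec Bool n → ℕ
  w b y = if V G (b ∷ y) then ℓ b y else 0
  W b y = if V G (b ∷ y) then glue G ℓ (b ∷ y) else 0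
  gain : ∀ y → 2 * m y + (w false y + w true y) ≤ W false y + W true y
  gain y = matching-gain (matched G y) _ _ (ℓ false y) (ℓ true y)
             (λ e → matched⇒V G e false) (λ e → matched⇒V G e true)

geodesicBound : (n : ℕ) (G : Subgraph n) → GeodesicBound G
geodesicBound zero G = record
  { bound = λ _ → 0
  ; realised = λ { [] v → [] , stop v , [] , z≤n }
  ; edges≤potential = z≤n
  }
geodesicBound (suc n) G = record
  { bound = glue G ℓ
  ; realised = glue-realised G ℓ (λ b → realised (sliceBound b))
  ; edges≤potential = glue-edges≤potential G ℓ (λ b → edges≤potential (sliceBound b))
  }
  where
  sliceBound : ∀ b → GeodesicBound (slice b G)
  sliceBound b = geodesicBound n (slice b G)
  ℓ : Bool → Vec Bool n → ℕ
  ℓ b = bound (sliceBound b)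

longGeodesic-average : {G : Subgraph n} → GeodesicBound G → 1 ≤ numVertices G →
  Σ (Vec Bool n) λ x → Σ (List (Fin n)) λ ds →
    PathFrom G x ds × Unique ds × 2 * numEdges G ≤ length ds * numVertices G
longGeodesic-average {n} {G} β |V|≥1 with ∃-≥-average (bound β) (filterᵇ (V G) (allVertices n)) |V|≥1
... | x , x∈V , average≤ with realised β x (∈-filterᵇ⁻ (allVertices n) x∈V)
... | ds , path , unique , ℓx≤ = x , ds , path , unique , (begin
  2 * numEdges G                                     ≤⟨ edges≤potential β ⟩
  potential G (bound β)                              ≡⟨ sym (sum-map-filterᵇ (V G) (bound β) (allVertices n)) ⟩
  sum (map (bound β) (filterᵇ (V G) (allVertices n))) ≤⟨ average≤ ⟩
  numVertices G * bound β x                          ≤⟨ *-monoʳ-≤ (numVertices G) ℓx≤ ⟩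
  numVertices G * length ds                          ≡⟨ *-comm (numVertices G) (length ds) ⟩
  length ds * numVertices G                          ∎)
  where open ≤-Reasoning

theorem2 : (n : ℕ) → 1 ≤ n → (G : Subgraph n) → 1 ≤ numVertices G →
    Σ (Vec Bool n) λ x → Σ (List (Fin n)) λ ds →
    PathFrom G x ds × Unique ds × 2 * numEdges G ≤ length ds * numVertices G
theorem2 n _ G = longGeodesic-average (geodesicBound n G)
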